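{- For any repeat $w$ in a string $S$ over alphabet $\Sigma$, $\phi_S(w)\le \min\{|\Sigma^L_w|,|\Sigma^R_w|\}$, where $\Sigma^L_w=\{\alpha\in\Sigma \mid \mathrm{occ}_S(\alpha w)\ge 1\}$ is the set of left-extensions of $w$ in $S$ and $\Sigma^R_w=\{\beta\in\Sigma\mid \mathrm{occ}_S(w\beta)\ge 1\}$ is the set of right-extensions of $w$ in $S$.
   Context: For strings $w,S$, $\mathrm{occ}_S(w)$ denotes the number of starting positions $i$ with $S[i..i+|w|-1]=w$. A repeat in $S$ is a string $w$ with $\mathrm{occ}_S(w)\ge 2$. For a repeat $w$ of $S$, $\Phi_S(w) = \{(\alpha,\beta)\in\Sigma\times\Sigma \mid \mathrm{occ}_S(\alpha w\beta)=\mathrm{occ}_S(\alpha w)=\mathrm{occ}_S(w\beta)=1\}$ and the net frequency is $\phi_S(w)=|\Phi_S(w)|$. -}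

module Defs where

open import Data.Nat using (ℕ; zero; suc; _≡ᵇ_)
open import Data.Bool using (Bool; true; false; _∧_)
open import Data.Fin using (Fin; _≟_)
open import Data.List using (List; []; _∷_; _++_; [_]; length; filter; allFin; cartesianProduct)
open import Data.Product using (_×_; _,_)
open import Relation.Nullary using (does)
open import Relation.Nullary.Decidable using (_×-dec_)

Str : ℕ → Set
Str k = List (Fin k)

isPrefix : ∀ {k} → Str k → Str k → Bool
isPrefix [] t = true
isPrefix (a ∷ w) [] = false
isPrefix (a ∷ w) (b ∷ t) = does (a ≟ b) ∧ isPrefix w t

-- occ S w = number of starting positions i (0 ≤ i < |S|, or i = |S| when w empty)
-- with S[i..i+|w|-1] = w; i.e. number of suffixes of S (including the empty
-- suffix) that have w as a prefix.
occ : ∀ {k} → Str k → Str k → ℕ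
occ [] w with isPrefix w []
... | true = 1
... | false = 0
occ (a ∷ S) w with isPrefix w (a ∷ S)
... | true = suc (occ S w)
... | false = occ S w

Repeat : ∀ {k} → Str k → Str k → Set
Repeat S w = 2 Data.Nat.≤ occ S w
  where import Data.Nat

Φ : ∀ {k} → Str k → Str k → List (Fin k × Fin k)
Φ {k} S w = filter (λ (p : Fin k × Fin k) → cond p) (cartesianProduct (allFin k) (allFin k))
  where
  open import Relation.Nullary using (Dec)
  open import Relation.Binary.PropositionalEquality using (_≡_)
  open import Data.Nat.Properties using () renaming (_≟_ to _≟ℕ_)
  cond : (p : Fin k × Fin k) → Dec _
  cond (α , β) = (occ S (α ∷ w ++ [ β ]) ≟ℕ 1) ×-dec ((occ S (α ∷ w) ≟ℕ 1) ×-dec (occ S (w ++ [ β ]) ≟ℕ 1))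

φ : ∀ {k} → Str k → Str k → ℕ
φ S w = length (Φ S w)

ΣL : ∀ {k} → Str k → Str k → List (Fin k)
ΣL {k} S w = filter (λ α → 1 ≤? occ S (α ∷ w)) (allFin k)
  where open import Data.Nat using (_≤?_)

ΣR : ∀ {k} → Str k → Str k → List (Fin k)
ΣR {k} S w = filter (λ β → 1 ≤? occ S (w ++ [ β ])) (allFin k)
  where open import Data.Nat using (_≤?_)

-- If (α , β) and (α , β′) both lie in Φ_S(w) with β ≠ β′, the occurrences of αwβ and αwβ′
-- are disjoint sets of occurrences of αw, so 1 + 1 ≤ occ(αw) = 1.  Hence α ↦ (α , β) is
-- injective on Φ_S(w), giving φ_S(w) ≤ |Σᴸ_w|; symmetrically, the occurrences of αwβ and
-- α′wβ are disjoint occurrences of wβ, giving φ_S(w) ≤ |Σᴿ_w|.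
module Submission where

open import Defs
open import Data.Nat using (ℕ; _≤_; _⊓_)
open import Data.List using (length)

open import Data.Bool using (Bool; true; false)
open import Data.Empty using (⊥)
open import Data.Fin using (Fin; _≟_)
open import Data.List using (List; []; _∷_; _++_; [_]; allFin; cartesianProduct)
open import Data.List.Properties using (length-removeAt′)
open import Data.List.Membership.Propositional using (_∈_)
open import Data.List.Membership.Propositional.Properties using (∈-filter⁺; ∈-filter⁻; ∈-allFin)
import Data.List.Relation.Unary.All as All
open import Data.List.Relation.Unary.AllPairs using (_∷_)
open import Data.List.Relation.Unary.Any using (here; there; _─_)
open import Data.List.Relation.Unary.Unique.Propositional using (Unique)
import Data.List.Relation.Unary.Unique.Propositional.Properties as Unique
open import Data.Nat using (suc; _+_; z≤n; s≤s; _≤?_)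
open import Data.Nat.Properties
  using (≤-reflexive; ≤-trans; +-mono-≤; +-monoˡ-≤; +-monoʳ-≤; m≤n+m; +-identityʳ; ⊓-glb;
         +-commutativeSemigroup; module ≤-Reasoning)
open import Algebra.Properties.CommutativeSemigroup +-commutativeSemigroup using (interchange)
open import Data.Product using (_×_; _,_; proj₁; proj₂)
open import Function using (_∘_)
open import Relation.Binary.PropositionalEquality using (_≡_; _≢_; refl; sym; trans; cong; cong₂)
open import Relation.Nullary using (yes; no; contradiction)

∈-─ : ∀ {A : Set} {x y : A} {ys : List A} (x∈ys : x ∈ ys) → y ∈ ys → y ≢ x → y ∈ (ys ─ x∈ys)
∈-─ (here refl)  (here refl)  y≢x = contradiction refl y≢x
∈-─ (here refl)  (there y∈ys) _   = y∈ys
∈-─ (there _)    (here y≡z)   _   = here y≡z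
∈-─ (there x∈ys) (there y∈ys) y≢x = there (∈-─ x∈ys y∈ys y≢x)

length-≤-injection : ∀ {A B : Set} (f : A → B) {xs : List A} {ys : List B} → Unique xs →
  (∀ {x} → x ∈ xs → f x ∈ ys) →
  (∀ {x y} → x ∈ xs → y ∈ xs → f x ≡ f y → x ≡ y) →
  length xs ≤ length ys
length-≤-injection f {[]}     _             _    _   = z≤n
length-≤-injection f {x ∷ xs} {ys} (x∉xs ∷ xs!) maps inj = begin
  suc (length xs)           ≤⟨ s≤s (length-≤-injection f xs! maps′ (λ p q → inj (there p) (there q))) ⟩
  suc (length (ys ─ fx∈ys)) ≡⟨ sym (length-removeAt′ ys _) ⟩
  length ys                 ∎
  where
  open ≤-Reasoning
  fx∈ys = maps (here refl)
  maps′ : ∀ {y} → y ∈ xs → f y ∈ (ys ─ fx∈ys)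
  maps′ y∈xs = ∈-─ fx∈ys (maps (there y∈xs))
    (λ fy≡fx → All.lookup x∉xs y∈xs (sym (inj (there y∈xs) (here refl) fy≡fx)))

indicator : Bool → ℕ
indicator true  = 1
indicator false = 0

occ-[] : ∀ {k} (w : Str k) → occ [] w ≡ indicator (isPrefix w [])
occ-[] w with isPrefix w []
... | true  = refl
... | false = refl

occ-∷ : ∀ {k} (a : Fin k) (S w : Str k) → occ (a ∷ S) w ≡ indicator (isPrefix w (a ∷ S)) + occ S w
occ-∷ a S w with isPrefix w (a ∷ S)
... | true  = refl
... | false = refl

isPrefix-∷ʳ-disjoint : ∀ {k} (u t : Str k) {β β′ : Fin k} → β ≢ β′ →
  indicator (isPrefix (u ++ [ β ]) t) + indicator (isPrefix (u ++ [ β′ ]) t) ≤ indicator (isPrefix u t)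
isPrefix-∷ʳ-disjoint []      []      _ = z≤n
isPrefix-∷ʳ-disjoint []      (b ∷ t) {β} {β′} β≢β′ with β ≟ b | β′ ≟ b
... | yes refl | yes refl = contradiction refl β≢β′
... | yes _    | no _     = s≤s z≤n
... | no _     | yes _    = s≤s z≤n
... | no _     | no _     = z≤n
isPrefix-∷ʳ-disjoint (a ∷ u) []      _ = z≤n
isPrefix-∷ʳ-disjoint (a ∷ u) (b ∷ t) β≢β′ with a ≟ b
... | yes _ = isPrefix-∷ʳ-disjoint u t β≢β′
... | no _  = z≤n

isPrefix-∷-disjoint : ∀ {k} (a : Fin k) (u t : Str k) {α α′ : Fin k} → α ≢ α′ →
  indicator (isPrefix (α ∷ u) (a ∷ t)) + indicator (isPrefix (α′ ∷ u) (a ∷ t)) ≤ indicator (isPrefix u t)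
isPrefix-∷-disjoint a u t {α} {α′} α≢α′ with isPrefix u t | α ≟ a | α′ ≟ a
... | true  | yes refl | yes refl = contradiction refl α≢α′
... | true  | yes _    | no _     = s≤s z≤n
... | true  | no _     | yes _    = s≤s z≤n
... | true  | no _     | no _     = z≤n
... | false | yes _    | yes _    = z≤n
... | false | yes _    | no _     = z≤n
... | false | no _     | yes _    = z≤n
... | false | no _     | no _     = z≤n

occ-+-≤ : ∀ {k} (S : Str k) {u₁ u₂ u : Str k} →
  (∀ t → indicator (isPrefix u₁ t) + indicator (isPrefix u₂ t) ≤ indicator (isPrefix u t)) →
  occ S u₁ + occ S u₂ ≤ occ S u
occ-+-≤ [] {u₁} {u₂} {u} h rewrite occ-[] u₁ | occ-[] u₂ | occ-[] u = h []
occ-+-≤ (a ∷ S) {u₁} {u₂} {u} h = begin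
  occ (a ∷ S) u₁ + occ (a ∷ S) u₂          ≡⟨ cong₂ _+_ (occ-∷ a S u₁) (occ-∷ a S u₂) ⟩
  (i₁ + occ S u₁) + (i₂ + occ S u₂)        ≡⟨ interchange i₁ _ i₂ _ ⟩
  (i₁ + i₂) + (occ S u₁ + occ S u₂)        ≤⟨ +-mono-≤ (h (a ∷ S)) (occ-+-≤ S h) ⟩
  indicator (isPrefix u (a ∷ S)) + occ S u ≡⟨ sym (occ-∷ a S u) ⟩
  occ (a ∷ S) u                            ∎
  where
  open ≤-Reasoning
  i₁ = indicator (isPrefix u₁ (a ∷ S))
  i₂ = indicator (isPrefix u₂ (a ∷ S))

occ-∷ʳ-disjoint : ∀ {k} (S u : Str k) {β β′ : Fin k} → β ≢ β′ →
  occ S (u ++ [ β ]) + occ S (u ++ [ β′ ]) ≤ occ S u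
occ-∷ʳ-disjoint S u β≢β′ = occ-+-≤ S (λ t → isPrefix-∷ʳ-disjoint u t β≢β′)

-- An occurrence of u at the start of S is preceded by no letter, so it extends to neither
-- α ∷ u nor α′ ∷ u; counting it as well is what makes the statement inductive.
occ-∷-disjoint′ : ∀ {k} (S u : Str k) {α α′ : Fin k} → α ≢ α′ →
  indicator (isPrefix u S) + (occ S (α ∷ u) + occ S (α′ ∷ u)) ≤ occ S u
occ-∷-disjoint′ []      u _ = ≤-reflexive (trans (+-identityʳ _) (sym (occ-[] u)))
occ-∷-disjoint′ (a ∷ S) u {α} {α′} α≢α′ = begin
  i + (occ (a ∷ S) (α ∷ u) + occ (a ∷ S) (α′ ∷ u))
    ≡⟨ cong (i +_) (cong₂ _+_ (occ-∷ a S (α ∷ u)) (occ-∷ a S (α′ ∷ u))) ⟩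
  i + ((x + occ S (α ∷ u)) + (x′ + occ S (α′ ∷ u)))
    ≡⟨ cong (i +_) (interchange x _ x′ _) ⟩
  i + ((x + x′) + (occ S (α ∷ u) + occ S (α′ ∷ u)))
    ≤⟨ +-monoʳ-≤ i (+-monoˡ-≤ _ (isPrefix-∷-disjoint a u S α≢α′)) ⟩
  i + (indicator (isPrefix u S) + (occ S (α ∷ u) + occ S (α′ ∷ u)))
    ≤⟨ +-monoʳ-≤ i (occ-∷-disjoint′ S u α≢α′) ⟩
  i + occ S u
    ≡⟨ sym (occ-∷ a S u) ⟩
  occ (a ∷ S) u ∎
  where
  open ≤-Reasoning
  i  = indicator (isPrefix u (a ∷ S))
  x  = indicator (isPrefix (α ∷ u) (a ∷ S))
  x′ = indicator (isPrefix (α′ ∷ u) (a ∷ S))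

occ-∷-disjoint : ∀ {k} (S u : Str k) {α α′ : Fin k} → α ≢ α′ →
  occ S (α ∷ u) + occ S (α′ ∷ u) ≤ occ S u
occ-∷-disjoint S u α≢α′ = ≤-trans (m≤n+m _ (indicator (isPrefix u S))) (occ-∷-disjoint′ S u α≢α′)

module _ {k : ℕ} (S w : Str k) where

  ∈Φ⁻ : ∀ {α β} → (α , β) ∈ Φ S w →
    occ S (α ∷ w ++ [ β ]) ≡ 1 × occ S (α ∷ w) ≡ 1 × occ S (w ++ [ β ]) ≡ 1
  ∈Φ⁻ = proj₂ ∘ ∈-filter⁻ _ {xs = cartesianProduct (allFin k) (allFin k)}

  Φ-unique : Unique (Φ S w)
  Φ-unique = Unique.filter⁺ _ (Unique.cartesianProduct⁺ (Unique.allFin⁺ k) (Unique.allFin⁺ k))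

  private
    1+1≰1 : ∀ {m n o : ℕ} → m ≡ 1 → n ≡ 1 → o ≡ 1 → m + n ≤ o → ⊥
    1+1≰1 refl refl refl (s≤s ())

  Φ-proj₁-injective : ∀ {p q} → p ∈ Φ S w → q ∈ Φ S w → proj₁ p ≡ proj₁ q → p ≡ q
  Φ-proj₁-injective {α , β} {.α , β′} p∈Φ q∈Φ refl with β ≟ β′
  ... | yes refl = refl
  ... | no β≢β′  = contradiction (occ-∷ʳ-disjoint S (α ∷ w) β≢β′)
                     (1+1≰1 (proj₁ (∈Φ⁻ p∈Φ)) (proj₁ (∈Φ⁻ q∈Φ)) (proj₁ (proj₂ (∈Φ⁻ p∈Φ))))

  Φ-proj₂-injective : ∀ {p q} → p ∈ Φ S w → q ∈ Φ S w → proj₂ p ≡ proj₂ q → p ≡ q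
  Φ-proj₂-injective {α , β} {α′ , .β} p∈Φ q∈Φ refl with α ≟ α′
  ... | yes refl = refl
  ... | no α≢α′  = contradiction (occ-∷-disjoint S (w ++ [ β ]) α≢α′)
                     (1+1≰1 (proj₁ (∈Φ⁻ p∈Φ)) (proj₁ (∈Φ⁻ q∈Φ)) (proj₂ (proj₂ (∈Φ⁻ p∈Φ))))

  proj₁∈ΣL : ∀ {p} → p ∈ Φ S w → proj₁ p ∈ ΣL S w
  proj₁∈ΣL {α , _} p∈Φ =
    ∈-filter⁺ (λ α → 1 ≤? occ S (α ∷ w)) (∈-allFin α) (≤-reflexive (sym (proj₁ (proj₂ (∈Φ⁻ p∈Φ)))))

  proj₂∈ΣR : ∀ {p} → p ∈ Φ S w → proj₂ p ∈ ΣR S w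
  proj₂∈ΣR {_ , β} p∈Φ =
    ∈-filter⁺ (λ β → 1 ≤? occ S (w ++ [ β ])) (∈-allFin β) (≤-reflexive (sym (proj₂ (proj₂ (∈Φ⁻ p∈Φ)))))

  φ≤|ΣL| : φ S w ≤ length (ΣL S w)
  φ≤|ΣL| = length-≤-injection proj₁ Φ-unique proj₁∈ΣL Φ-proj₁-injective

  φ≤|ΣR| : φ S w ≤ length (ΣR S w)
  φ≤|ΣR| = length-≤-injection proj₂ Φ-unique proj₂∈ΣR Φ-proj₂-injective

-- The bound holds for every w.
corollary1 : (k : ℕ) (S w : Str k) → Repeat S w →
    φ S w ≤ length (ΣL S w) ⊓ length (ΣR S w)
corollary1 k S w _ = ⊓-glb (φ≤|ΣL| S w) (φ≤|ΣR| S w)
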